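{- Let $G$ be a finite group, $\alpha$ an involutory automorphism of $G$, $S=\{s_1,\dots,s_r\}$ a nonempty generalized Cayley subset of $G$ induced by $\alpha$ (with $s_1,\dots,s_r$ distinct), and $X$ a nonempty subset of $G$. The following are equivalent: (i) $X$ is a total perfect code of $GC(G,S,\alpha)$; (ii) $\{\alpha(X)s_1,\dots,\alpha(X)s_r\}$ is a partition of $G$; (iii) $|G|=|X|r$ and $\alpha(X^{ -1})\alpha(X)\cap SS^{ -1}=\{e\}$.
   Context: $G$ is a finite group with identity $e$, and $\alpha$ is an involutory automorphism of $G$ ($\alpha\in\mathrm{Aut}(G)$, $\alpha^2=\mathrm{id}\neq\alpha$). Set $\omega_\alpha(G)=\{\alpha(g^{ -1})g\mid g\in G\}$. A subset $S\subseteq G$ is a generalized Cayley subset of $G$ induced by $\alpha$ if $S\cap\omega_\alpha(G)=\emptyset$ and $\alpha(S)=S^{ -1}$. The generalized Cayley graph $GC(G,S,\alpha)$ has vertex set $G$ and edge set $\{\{g,h\}\mid \alpha(g^{ -1})h\in S\}$. A subset $C$ of the vertex set of a graph is a total perfect code if every vertex of the graph has exactly one neighbour in $C$. For subsets $A,B\subseteq G$ and $s\in G$: $\alpha(A)=\{\alpha(a)\mid a\in A\}$, $A^{ -1}=\{a^{ -1}\mid a\in A\}$, $AB=\{ab\mid a\in A,b\in B\}$, $As=\{as\mid a\in A\}$. -}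

module Defs where

open import Level using (0ℓ)
open import Data.Nat using (ℕ)
open import Data.Fin using (Fin)
open import Data.Fin.Subset using (Subset; _∈_)
open import Data.Product using (Σ; ∃; ∃-syntax; _×_; _,_)
open import Data.Sum using (_⊎_)
open import Relation.Nullary using (¬_)
open import Relation.Unary using (Pred)
open import Relation.Binary.PropositionalEquality using (_≡_)
open import Algebra.Bundles using (RawGroup)
open import Algebra.Structures using (IsGroup)
open import Algebra.Morphism.Structures using (module GroupMorphisms)

-- A finite group of order n: its elements are Fin n, with propositional
-- equality as the equality of the group.  (Every finite group is isomorphic
-- to one of this form.)
record FinGroup (n : ℕ) : Set where
  infixl 7 _∙_
  infix  8 _⁻¹
  field
    _∙_     : Fin n → Fin n → Fin n
    ε       : Fin n
    _⁻¹     : Fin n → Fin n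
    isGroup : IsGroup _≡_ _∙_ ε _⁻¹

  rawGroup : RawGroup 0ℓ 0ℓ
  rawGroup = record { _≈_ = _≡_ ; _∙_ = _∙_ ; ε = ε ; _⁻¹ = _⁻¹ }

⟪_⟫ : {n : ℕ} → Subset n → Pred (Fin n) 0ℓ
⟪ X ⟫ g = g ∈ X

module _ {n : ℕ} (G : FinGroup n) where
  open FinGroup G

  IsAutomorphism : (Fin n → Fin n) → Set
  IsAutomorphism α = GroupMorphisms.IsGroupIsomorphism rawGroup rawGroup α

  IsInvolutoryAutomorphism : (Fin n → Fin n) → Set
  IsInvolutoryAutomorphism α =
    IsAutomorphism α × (∀ g → α (α g) ≡ g) × ¬ (∀ g → α g ≡ g)

  img : (Fin n → Fin n) → Pred (Fin n) 0ℓ → Pred (Fin n) 0ℓ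
  img α A g = ∃[ a ] (A a × g ≡ α a)

  inv : Pred (Fin n) 0ℓ → Pred (Fin n) 0ℓ
  inv A g = ∃[ a ] (A a × g ≡ a ⁻¹)

  prod : Pred (Fin n) 0ℓ → Pred (Fin n) 0ℓ → Pred (Fin n) 0ℓ
  prod A B g = ∃[ a ] ∃[ b ] (A a × B b × g ≡ a ∙ b)

  rtrans : Pred (Fin n) 0ℓ → Fin n → Pred (Fin n) 0ℓ
  rtrans A s g = ∃[ a ] (A a × g ≡ a ∙ s)

  ω : (Fin n → Fin n) → Pred (Fin n) 0ℓ
  ω α x = ∃[ g ] (x ≡ α (g ⁻¹) ∙ g)

  IsGenCayleySubset : (Fin n → Fin n) → Subset n → Set
  IsGenCayleySubset α S =
    (∀ x → x ∈ S → ¬ ω α x) ×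
    (∀ x → (img α ⟪ S ⟫ x → inv ⟪ S ⟫ x) × (inv ⟪ S ⟫ x → img α ⟪ S ⟫ x))

  -- edges of GC(G,S,α): {g,h} is an edge iff it can be written {g',h'}
  -- with α(g'⁻¹) h' ∈ S
  Adj : (Fin n → Fin n) → Subset n → Fin n → Fin n → Set
  Adj α S g h = (α (g ⁻¹) ∙ h ∈ S) ⊎ (α (h ⁻¹) ∙ g ∈ S)

  IsTotalPerfectCode : (Fin n → Fin n) → Subset n → Subset n → Set
  IsTotalPerfectCode α S C =
    ∀ g → (∃[ h ] (h ∈ C × Adj α S g h)) ×
          (∀ h h' → h ∈ C → Adj α S g h → h' ∈ C → Adj α S g h' → h ≡ h')

  -- { B s | s ∈ S } (indexed by the distinct elements s of S) is a partition
  -- of G: every block is nonempty, and every g ∈ G lies in B s for exactly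
  -- one s ∈ S (i.e. the blocks cover G and are pairwise disjoint).
  IsPartitionBy : Pred (Fin n) 0ℓ → Subset n → Set
  IsPartitionBy B S =
    (∀ s → s ∈ S → ∃[ g ] rtrans B s g) ×
    (∀ g → (∃[ s ] (s ∈ S × rtrans B s g)) ×
           (∀ s s' → s ∈ S → rtrans B s g → s' ∈ S → rtrans B s' g → s ≡ s'))

-- Every condition says that each g ∈ G factorises uniquely as g = α(x) s with
-- x ∈ X and s ∈ S.  For (i): since α(S) = S⁻¹ and α² = id, g and x ∈ X are
-- adjacent exactly when s = α(x⁻¹) g lies in S.  For (iii): uniqueness means that
-- (x , s) ↦ α(x) s is injective on X × S, so it is onto G iff |G| = |X| |S|;
-- and two factorisations α(x) s = α(y) t are the same thing as an element
-- α(x)⁻¹ α(y) = s t⁻¹ of α(X⁻¹) α(X) ∩ S S⁻¹.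
module Submission where

open import Level using (0ℓ)
open import Data.Nat using (ℕ; suc; s≤s; _*_)
open import Data.Nat.Properties using (<-irrefl)
open import Data.Vec.Base using (_∷_; here; there)
open import Data.Bool using (true; false)
open import Data.Fin using (Fin; zero; suc; combine; remQuot; punchOut)
open import Data.Fin.Properties
  using (suc-injective; any?; _≟_; injective⇒≤; cantor-schröder-bernstein;
         punchOut-injective; combine-remQuot; remQuot-combine)
open import Data.Fin.Subset using (Subset; Nonempty; ∣_∣; _∈_)
open import Data.Product using (_×_; _,_; proj₁; proj₂; ∃; ∃₂)
open import Data.Product.Function.NonDependent.Propositional using (_×-⇔_)
open import Data.Sum using (inj₁; inj₂)
open import Data.Empty using (⊥-elim)
open import Algebra.Bundles using (Group)
open import Algebra.Morphism.Structures using (module GroupMorphisms)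
open import Function.Base using (_∘_)
open import Function.Bundles using (_⇔_; mk⇔; Equivalence)
open import Function.Construct.Composition using (_⇔-∘_)
open import Function.Construct.Symmetry using (⇔-sym)
open import Function.Construct.Identity using (⇔-id)
open import Function.Definitions using (Injective; StrictlySurjective)
open import Relation.Nullary using (yes; no)
open import Relation.Binary.PropositionalEquality
  using (_≡_; refl; sym; trans; cong; cong₂; subst; module ≡-Reasoning)
open import Defs

injective∧strictlySurjective⇒≡ : ∀ {m n} {f : Fin m → Fin n} →
  Injective _≡_ _≡_ f → StrictlySurjective _≡_ f → m ≡ n
injective∧strictlySurjective⇒≡ {f = f} f-injective f-onto =
  cantor-schröder-bernstein f-injective section-injective
  where
  section-injective : Injective _≡_ _≡_ (proj₁ ∘ f-onto)
  section-injective {y} {y′} e =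
    trans (sym (proj₂ (f-onto y))) (trans (cong f e) (proj₂ (f-onto y′)))

injective∧≡⇒strictlySurjective : ∀ {m n} {f : Fin m → Fin n} →
  Injective _≡_ _≡_ f → m ≡ n → StrictlySurjective _≡_ f
injective∧≡⇒strictlySurjective {n = suc _} {f = f} f-injective m≡n y
  with any? (λ x → f x ≟ y)
... | yes hit = hit
... | no miss = ⊥-elim (<-irrefl m≡n (s≤s (injective⇒≤ punched-injective)))
  where
  punched : Fin _ → Fin _
  punched x = punchOut {i = y} (miss ∘ (x ,_) ∘ sym)

  punched-injective : Injective _≡_ _≡_ punched
  punched-injective = f-injective ∘ punchOut-injective {i = y} _ _

element : ∀ {n} (p : Subset n) → Fin ∣ p ∣ → Fin n
element (true  ∷ p) zero    = zero
element (true  ∷ p) (suc i) = suc (element p i)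
element (false ∷ p) i       = suc (element p i)

element-∈ : ∀ {n} (p : Subset n) (i : Fin ∣ p ∣) → element p i ∈ p
element-∈ (true  ∷ p) zero    = here
element-∈ (true  ∷ p) (suc i) = there (element-∈ p i)
element-∈ (false ∷ p) i       = there (element-∈ p i)

element-injective : ∀ {n} (p : Subset n) → Injective _≡_ _≡_ (element p)
element-injective (true  ∷ p) {zero}  {zero}  e = refl
element-injective (true  ∷ p) {suc i} {suc j} e =
  cong suc (element-injective p (suc-injective e))
element-injective (false ∷ p) e = element-injective p (suc-injective e)

element-onto : ∀ {n} (p : Subset n) {x : Fin n} → x ∈ p → ∃ λ i → element p i ≡ x
element-onto (true ∷ p) here = zero , refl
element-onto (true ∷ p) (there x∈p) with i , refl ← element-onto p x∈p = suc i , refl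
element-onto (false ∷ p) (there x∈p) with i , refl ← element-onto p x∈p = i , refl

module FinGroupProperties {n : ℕ} (G : FinGroup n) where
  open FinGroup G

  group : Group 0ℓ 0ℓ
  group = record { isGroup = isGroup }

  open import Algebra.Properties.Group group public
  open Group group public using (assoc; inverseʳ; inverseˡ)
  open ≡-Reasoning

  ≡∙⇔≡⁻¹∙ : ∀ {g a s} → g ≡ a ∙ s ⇔ s ≡ a ⁻¹ ∙ g
  ≡∙⇔≡⁻¹∙ {g} {a} {s} = mk⇔ (λ e → y≈x\\z a s g (sym e))
                             (λ { refl → sym (\\-leftDividesˡ a g) })

  ∙≡∙⇔⁻¹∙≡∙⁻¹ : ∀ {a b s t} → a ∙ s ≡ b ∙ t ⇔ a ⁻¹ ∙ b ≡ s ∙ t ⁻¹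
  ∙≡∙⇔⁻¹∙≡∙⁻¹ {a} {b} {s} {t} = mk⇔ to from
    where
    to : a ∙ s ≡ b ∙ t → a ⁻¹ ∙ b ≡ s ∙ t ⁻¹
    to e = begin
      a ⁻¹ ∙ b               ≡⟨ cong (a ⁻¹ ∙_) (sym (//-rightDividesʳ t b)) ⟩
      a ⁻¹ ∙ ((b ∙ t) ∙ t ⁻¹) ≡⟨ cong (λ u → a ⁻¹ ∙ (u ∙ t ⁻¹)) (sym e) ⟩
      a ⁻¹ ∙ ((a ∙ s) ∙ t ⁻¹) ≡⟨ sym (assoc _ _ _) ⟩
      (a ⁻¹ ∙ (a ∙ s)) ∙ t ⁻¹ ≡⟨ cong (_∙ t ⁻¹) (\\-leftDividesʳ a s) ⟩
      s ∙ t ⁻¹               ∎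

    from : a ⁻¹ ∙ b ≡ s ∙ t ⁻¹ → a ∙ s ≡ b ∙ t
    from e = sym (begin
      b ∙ t                  ≡⟨ cong (_∙ t) (sym (\\-leftDividesˡ a b)) ⟩
      (a ∙ (a ⁻¹ ∙ b)) ∙ t   ≡⟨ cong (λ u → (a ∙ u) ∙ t) e ⟩
      (a ∙ (s ∙ t ⁻¹)) ∙ t   ≡⟨ assoc _ _ _ ⟩
      a ∙ ((s ∙ t ⁻¹) ∙ t)   ≡⟨ cong (a ∙_) (//-rightDividesˡ t s) ⟩
      a ∙ s                  ∎)

module Factorisation {n : ℕ} (G : FinGroup n) {α : Fin n → Fin n}
  (α-monomorphism : GroupMorphisms.IsGroupMonomorphism
                      (FinGroup.rawGroup G) (FinGroup.rawGroup G) α)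
  (X S : Subset n) where
  open FinGroup G
  open FinGroupProperties G
  open GroupMorphisms.IsGroupMonomorphism α-monomorphism
    using (∙-homo; ⁻¹-homo) renaming (injective to α-injective)

  Factorises : Fin n → Fin n → Fin n → Set
  Factorises g x s = x ∈ X × s ∈ S × g ≡ α x ∙ s

  FactorisationExists : Set
  FactorisationExists = ∀ g → ∃₂ (Factorises g)

  FactorisationUnique : Set
  FactorisationUnique = ∀ {g x s x′ s′} →
    Factorises g x s → Factorises g x′ s′ → x ≡ x′ × s ≡ s′

  UniqueFactorisation : Set
  UniqueFactorisation = FactorisationExists × FactorisationUnique

  cofactor : ∀ {g x s} → Factorises g x s → s ≡ α (x ⁻¹) ∙ g
  cofactor {g} {x} (_ , _ , e) =
    trans (Equivalence.to ≡∙⇔≡⁻¹∙ e) (cong (_∙ g) (sym (⁻¹-homo x)))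

  factorises-cofactor : ∀ {g x} → x ∈ X → α (x ⁻¹) ∙ g ∈ S →
                        Factorises g x (α (x ⁻¹) ∙ g)
  factorises-cofactor {g} {x} x∈X s∈S =
    x∈X , s∈S , Equivalence.from ≡∙⇔≡⁻¹∙ (cong (_∙ g) (⁻¹-homo x))

  factor-determines-cofactor : ∀ {g x s s′} →
    Factorises g x s → Factorises g x s′ → s ≡ s′
  factor-determines-cofactor r r′ = trans (cofactor r) (sym (cofactor r′))

  cofactor-determines-factor : ∀ {g x x′ s} →
    Factorises g x s → Factorises g x′ s → x ≡ x′
  cofactor-determines-factor (_ , _ , e) (_ , _ , e′) =
    α-injective (∙-cancelʳ _ _ _ (trans (sym e) e′))

  module Adjacency (α-involutive : ∀ g → α (α g) ≡ g)
                   (αS⊆S⁻¹ : ∀ u → img G α ⟪ S ⟫ u → inv G ⟪ S ⟫ u) where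

    adjacent⇔ : ∀ g h → Adj G α S g h ⇔ α (h ⁻¹) ∙ g ∈ S
    adjacent⇔ g h = mk⇔ to inj₂
      where
      open ≡-Reasoning
      to : Adj G α S g h → α (h ⁻¹) ∙ g ∈ S
      to (inj₂ s∈S) = s∈S
      to (inj₁ u∈S) with t , t∈S , αu≡t⁻¹ ← αS⊆S⁻¹ _ (_ , u∈S , refl) =
        subst (_∈ S) t≡ t∈S
        where
        t≡ : t ≡ α (h ⁻¹) ∙ g
        t≡ = begin
          t                       ≡⟨ sym (⁻¹-involutive t) ⟩
          t ⁻¹ ⁻¹                 ≡⟨ cong _⁻¹ (sym αu≡t⁻¹) ⟩
          α (α (g ⁻¹) ∙ h) ⁻¹     ≡⟨ cong _⁻¹ (∙-homo _ _) ⟩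
          (α (α (g ⁻¹)) ∙ α h) ⁻¹ ≡⟨ cong (λ u → (u ∙ α h) ⁻¹) (α-involutive _) ⟩
          (g ⁻¹ ∙ α h) ⁻¹         ≡⟨ ⁻¹-anti-homo-∙ _ _ ⟩
          α h ⁻¹ ∙ g ⁻¹ ⁻¹        ≡⟨ cong₂ _∙_ (sym (⁻¹-homo h)) (⁻¹-involutive g) ⟩
          α (h ⁻¹) ∙ g            ∎

    factorises⇒adjacent : ∀ {g x s} → Factorises g x s → Adj G α S g x
    factorises⇒adjacent r@(_ , s∈S , _) =
      Equivalence.from (adjacent⇔ _ _) (subst (_∈ S) (cofactor r) s∈S)

    adjacent⇒factorises : ∀ {g x} → x ∈ X → Adj G α S g x →
                          Factorises g x (α (x ⁻¹) ∙ g)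
    adjacent⇒factorises x∈X g~x =
      factorises-cofactor x∈X (Equivalence.to (adjacent⇔ _ _) g~x)

    totalPerfectCode⇔uniqueFactorisation :
      IsTotalPerfectCode G α S X ⇔ UniqueFactorisation
    totalPerfectCode⇔uniqueFactorisation = mk⇔ to from
      where
      to : IsTotalPerfectCode G α S X → UniqueFactorisation
      to code = exists , unique
        where
        exists : FactorisationExists
        exists g with h , h∈X , g~h ← proj₁ (code g) =
          h , _ , adjacent⇒factorises h∈X g~h
        unique : FactorisationUnique
        unique {g} r r′
          with refl ← proj₂ (code g) _ _ (proj₁ r) (factorises⇒adjacent r)
                                         (proj₁ r′) (factorises⇒adjacent r′) =
          refl , factor-determines-cofactor r r′

      from : UniqueFactorisation → IsTotalPerfectCode G α S X
      from (exists , unique) g =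
        (let x , _ , r = exists g in x , proj₁ r , factorises⇒adjacent r) ,
        λ h h′ h∈X g~h h′∈X g~h′ →
          proj₁ (unique (adjacent⇒factorises h∈X g~h) (adjacent⇒factorises h′∈X g~h′))

  partition⇔uniqueFactorisation :
    Nonempty X → IsPartitionBy G (img G α ⟪ X ⟫) S ⇔ UniqueFactorisation
  partition⇔uniqueFactorisation (x₀ , x₀∈X) = mk⇔ to from
    where
    inBlock⇒factorises : ∀ {g s} → s ∈ S → rtrans G (img G α ⟪ X ⟫) s g →
                         ∃ λ x → Factorises g x s
    inBlock⇒factorises s∈S (_ , (x , x∈X , refl) , e) = x , x∈X , s∈S , e

    factorises⇒inBlock : ∀ {g x s} → Factorises g x s → rtrans G (img G α ⟪ X ⟫) s g
    factorises⇒inBlock {x = x} (x∈X , _ , e) = α x , (x , x∈X , refl) , e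

    to : IsPartitionBy G (img G α ⟪ X ⟫) S → UniqueFactorisation
    to (_ , partition) = exists , unique
      where
      exists : FactorisationExists
      exists g with s , s∈S , g∈Xs ← proj₁ (partition g)
        with x , r ← inBlock⇒factorises s∈S g∈Xs = x , s , r
      unique : FactorisationUnique
      unique {g} r r′
        with refl ← proj₂ (partition g) _ _ (proj₁ (proj₂ r)) (factorises⇒inBlock r)
                                            (proj₁ (proj₂ r′)) (factorises⇒inBlock r′) =
        cofactor-determines-factor r r′ , refl

    from : UniqueFactorisation → IsPartitionBy G (img G α ⟪ X ⟫) S
    from (exists , unique) =
      (λ s s∈S → α x₀ ∙ s , factorises⇒inBlock (x₀∈X , s∈S , refl)) ,
      λ g → (let _ , s , r = exists g in s , proj₁ (proj₂ r) , factorises⇒inBlock r) ,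
            λ s s′ s∈S g∈Xs s′∈S g∈Xs′ →
              proj₂ (unique (proj₂ (inBlock⇒factorises s∈S g∈Xs))
                            (proj₂ (inBlock⇒factorises s′∈S g∈Xs′)))

  indices : Fin (∣ X ∣ * ∣ S ∣) → Fin ∣ X ∣ × Fin ∣ S ∣
  indices = remQuot ∣ S ∣

  multiply : Fin (∣ X ∣ * ∣ S ∣) → Fin n
  multiply k = let i , j = indices k in α (element X i) ∙ element S j

  multiply-factorises : ∀ {g} k → g ≡ multiply k →
    Factorises g (element X (proj₁ (indices k))) (element S (proj₂ (indices k)))
  multiply-factorises k e = element-∈ X _ , element-∈ S _ , e

  multiply-injective : FactorisationUnique → Injective _≡_ _≡_ multiply
  multiply-injective unique {k} {k′} e
    with x≡ , s≡ ← unique (multiply-factorises k refl) (multiply-factorises k′ e) =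
    begin
      k                                ≡⟨ combine-remQuot {∣ X ∣} ∣ S ∣ k ⟨
      combine (proj₁ (indices k)) _    ≡⟨ cong₂ combine (element-injective X x≡)
                                                        (element-injective S s≡) ⟩
      combine (proj₁ (indices k′)) _   ≡⟨ combine-remQuot {∣ X ∣} ∣ S ∣ k′ ⟩
      k′                               ∎
    where open ≡-Reasoning

  multiply-onto⇔exists : StrictlySurjective _≡_ multiply ⇔ FactorisationExists
  multiply-onto⇔exists = mk⇔ to from
    where
    to : StrictlySurjective _≡_ multiply → FactorisationExists
    to onto g with k , refl ← onto g = _ , _ , multiply-factorises k refl
    from : FactorisationExists → StrictlySurjective _≡_ multiply
    from exists g
      with _ , _ , x∈X , s∈S , e ← exists g
      with i , refl ← element-onto X x∈X
         | j , refl ← element-onto S s∈S =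
      combine i j ,
      trans (cong (λ (i , j) → α (element X i) ∙ element S j) (remQuot-combine i j))
            (sym e)

  uniqueFactorisation⇔counting :
    UniqueFactorisation ⇔ (n ≡ ∣ X ∣ * ∣ S ∣ × FactorisationUnique)
  uniqueFactorisation⇔counting = mk⇔
    (λ (exists , unique) →
      sym (injective∧strictlySurjective⇒≡ (multiply-injective unique)
                                           (Equivalence.from multiply-onto⇔exists exists)) ,
      unique)
    (λ (count , unique) →
      Equivalence.to multiply-onto⇔exists
        (injective∧≡⇒strictlySurjective (multiply-injective unique) (sym count)) ,
      unique)

  IntersectionTrivial : Set
  IntersectionTrivial = ∀ g →
    (prod G (img G α (inv G ⟪ X ⟫)) (img G α ⟪ X ⟫) g × prod G ⟪ S ⟫ (inv G ⟪ S ⟫) g)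
      ⇔ (g ≡ ε)

  α⁻¹∙α≡ε : ∀ x → α (x ⁻¹) ∙ α x ≡ ε
  α⁻¹∙α≡ε x = trans (cong (_∙ α x) (⁻¹-homo x)) (inverseˡ (α x))

  ∈α[X⁻¹]α[X] : ∀ {x y} → x ∈ X → y ∈ X →
                prod G (img G α (inv G ⟪ X ⟫)) (img G α ⟪ X ⟫) (α (x ⁻¹) ∙ α y)
  ∈α[X⁻¹]α[X] x∈X y∈X = _ , _ , (_ , (_ , x∈X , refl) , refl) , (_ , y∈X , refl) , refl

  ∈SS⁻¹ : ∀ {s t} → s ∈ S → t ∈ S → prod G ⟪ S ⟫ (inv G ⟪ S ⟫) (s ∙ t ⁻¹)
  ∈SS⁻¹ s∈S t∈S = _ , _ , s∈S , (_ , t∈S , refl) , refl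

  factorisationUnique⇔intersectionTrivial :
    Nonempty X → Nonempty S → FactorisationUnique ⇔ IntersectionTrivial
  factorisationUnique⇔intersectionTrivial (x₀ , x₀∈X) (s₀ , s₀∈S) = mk⇔ to from
    where
    to : FactorisationUnique → IntersectionTrivial
    to unique g = mk⇔ trivial (λ { refl → contains-ε })
      where
      trivial : prod G (img G α (inv G ⟪ X ⟫)) (img G α ⟪ X ⟫) g ×
                prod G ⟪ S ⟫ (inv G ⟪ S ⟫) g → g ≡ ε
      trivial ((_ , _ , (_ , (x , x∈X , refl) , refl) , (y , y∈X , refl) , refl) ,
               (s , _ , s∈S , (t , t∈S , refl) , e)) =
        subst (λ z → α (x ⁻¹) ∙ α z ≡ ε) x≡y (α⁻¹∙α≡ε x)
        where
        αxs≡αyt : α x ∙ s ≡ α y ∙ t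
        αxs≡αyt = Equivalence.from ∙≡∙⇔⁻¹∙≡∙⁻¹
                    (trans (cong (_∙ α y) (sym (⁻¹-homo x))) e)
        x≡y : x ≡ y
        x≡y = proj₁ (unique (x∈X , s∈S , refl) (y∈X , t∈S , αxs≡αyt))

      contains-ε : prod G (img G α (inv G ⟪ X ⟫)) (img G α ⟪ X ⟫) ε ×
                   prod G ⟪ S ⟫ (inv G ⟪ S ⟫) ε
      contains-ε = subst (prod G _ _) (α⁻¹∙α≡ε x₀) (∈α[X⁻¹]α[X] x₀∈X x₀∈X) ,
                   subst (prod G _ _) (inverseʳ s₀) (∈SS⁻¹ s₀∈S s₀∈S)

    from : IntersectionTrivial → FactorisationUnique
    from trivial {g} {x} {s} {y} {t} r@(x∈X , s∈S , e) r′@(y∈X , t∈S , e′) =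
      x≡y , factor-determines-cofactor r (subst (λ z → Factorises g z t) (sym x≡y) r′)
      where
      αx⁻¹∙αy≡s∙t⁻¹ : α (x ⁻¹) ∙ α y ≡ s ∙ t ⁻¹
      αx⁻¹∙αy≡s∙t⁻¹ = trans (cong (_∙ α y) (⁻¹-homo x))
                            (Equivalence.to ∙≡∙⇔⁻¹∙≡∙⁻¹ (trans (sym e) e′))

      αx⁻¹∙αy≡ε : α x ⁻¹ ∙ α y ≡ ε
      αx⁻¹∙αy≡ε = trans (cong (_∙ α y) (sym (⁻¹-homo x))) (Equivalence.to (trivial _)
        (∈α[X⁻¹]α[X] x∈X y∈X , subst (prod G _ _) (sym αx⁻¹∙αy≡s∙t⁻¹) (∈SS⁻¹ s∈S t∈S)))

      x≡y : x ≡ y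
      x≡y = sym (α-injective (trans (inverseʳ-unique _ _ αx⁻¹∙αy≡ε) (⁻¹-involutive (α x))))

proposition3p1 : ∀ {n : ℕ} (G : FinGroup n) (α : Fin n → Fin n) (S X : Subset n) →
    IsInvolutoryAutomorphism G α → IsGenCayleySubset G α S → Nonempty S → Nonempty X →
    (IsTotalPerfectCode G α S X ⇔ IsPartitionBy G (img G α ⟪ X ⟫) S) ×
    (IsTotalPerfectCode G α S X ⇔
      ((n ≡ ∣ X ∣ * ∣ S ∣) ×
       (∀ g → (prod G (img G α (inv G ⟪ X ⟫)) (img G α ⟪ X ⟫) g ×
               prod G ⟪ S ⟫ (inv G ⟪ S ⟫) g) ⇔ (g ≡ FinGroup.ε G))))
proposition3p1 G α S X (α-automorphism , α-involutive , _) (_ , αS≡S⁻¹) S-nonempty X-nonempty =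
  ⇔-sym (partition⇔uniqueFactorisation X-nonempty) ⇔-∘ code⇔unique ,
  ((⇔-id _ ×-⇔ factorisationUnique⇔intersectionTrivial X-nonempty S-nonempty)
     ⇔-∘ uniqueFactorisation⇔counting) ⇔-∘ code⇔unique
  where
  open GroupMorphisms.IsGroupIsomorphism α-automorphism using (isGroupMonomorphism)
  open Factorisation G isGroupMonomorphism X S
  open Adjacency α-involutive (proj₁ ∘ αS≡S⁻¹)
    renaming (totalPerfectCode⇔uniqueFactorisation to code⇔unique)
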